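{- If $G$ is a claw-free CIS graph, then $|V(G)|\le \alpha(G)\cdot\omega(G)$.
   Context: All graphs are finite, simple and non-null. A graph is CIS if every inclusion-maximal clique intersects every inclusion-maximal stable set. The claw is $K_{1,3}$; claw-free means no induced claw. $\alpha(G)$ and $\omega(G)$ are the maximum sizes of a stable set and of a clique in $G$. -}

module Defs where

open import Data.Nat using (ℕ; _≤_)
open import Data.Fin using (Fin)
open import Data.Fin.Subset using (Subset; _∈_; _∉_; ∣_∣; _⊆_)
open import Data.Product using (_×_; Σ; ∃; ∃-syntax)
open import Relation.Nullary using (¬_)
open import Relation.Binary.PropositionalEquality using (_≡_; _≢_)

record Graph (n : ℕ) : Set₁ where
  field
    Adj   : Fin n → Fin n → Set
    sym   : ∀ {u v} → Adj u v → Adj v u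
    irrefl : ∀ {u} → ¬ Adj u u

module _ {n : ℕ} (G : Graph n) where
  open Graph G

  IsClique : Subset n → Set
  IsClique S = ∀ u v → u ∈ S → v ∈ S → u ≢ v → Adj u v

  IsStable : Subset n → Set
  IsStable S = ∀ u v → u ∈ S → v ∈ S → ¬ Adj u v

  IsMaximalClique : Subset n → Set
  IsMaximalClique S = IsClique S × (∀ T → IsClique T → S ⊆ T → T ⊆ S)

  IsMaximalStable : Subset n → Set
  IsMaximalStable S = IsStable S × (∀ T → IsStable T → S ⊆ T → T ⊆ S)

  Intersects : Subset n → Subset n → Set
  Intersects S T = ∃[ v ] (v ∈ S × v ∈ T)

  IsCIS : Set
  IsCIS = ∀ C I → IsMaximalClique C → IsMaximalStable I → Intersects C I

  IsClawFree : Set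
  IsClawFree = ∀ c a b d → a ≢ b → a ≢ d → b ≢ d →
               ¬ (Adj c a × Adj c b × Adj c d ×
                  ¬ Adj a b × ¬ Adj a d × ¬ Adj b d)

  IsStabilityNumber : ℕ → Set
  IsStabilityNumber k = (∃[ S ] (IsStable S × ∣ S ∣ ≡ k)) × (∀ S → IsStable S → ∣ S ∣ ≤ k)

  IsCliqueNumber : ℕ → Set
  IsCliqueNumber k = (∃[ S ] (IsClique S × ∣ S ∣ ≡ k)) × (∀ S → IsClique S → ∣ S ∣ ≤ k)

-- Fix a maximum stable set S. For s ∈ S let K s be a maximal clique of the neighbourhood N(s),
-- and call x private to s if x ∈ N[s] and x has no neighbour in S other than s. Applying the
-- CIS property to the clique K s ∪ {s} and a stable pair {x, y} ⊆ N(s) ∖ K s produces a claw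
-- at s, so N(s) ∖ K s is a clique as well. An exchange argument against the maximality of S,
-- again combined with CIS, shows that every private vertex of s is adjacent to all of N[s].
-- Adding the private vertices to K s and to N(s) ∖ K s therefore gives two cliques for every
-- s ∈ S, and every vertex lies in at least two of these 2α cliques: a vertex private to some s
-- lies in both cliques of s, and any other vertex has two neighbours in S. Hence 2|V| ≤ 2αω.

module Submission where

open import Defs
open import Data.Nat using (ℕ; _≤_; _*_; suc; zero; _+_; _<_; z≤n; s≤s; _≤?_)
open import Data.Nat.Properties
  using (≤-trans; ≤-reflexive; <⇒≱; n≤1+n; m≤m+n; m≤n+m; +-comm; +-suc; +-identityʳ;
         +-mono-≤; +-monoˡ-≤; +-monoʳ-≤; *-cancelʳ-≤; +-0-commutativeMonoid; module ≤-Reasoning)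
open import Data.Nat.Tactic.RingSolver using (solve-∀)
open import Algebra.Properties.CommutativeMonoid.Sum +-0-commutativeMonoid
  using (sum; ∑-comm; ∑-distrib-+; sum-cong-≗)
open import Data.Bool using (if_then_else_)
open import Data.Fin using (Fin; zero; suc; _≟_)
open import Data.Fin.Properties using (all?; any?; ¬∀⟶∃¬)
open import Data.Fin.Subset using (Subset; _∈_; _∉_; ∣_∣; _⊆_; _∪_; ⁅_⁆; _-_; inside; outside; Lift)
  renaming (⊥ to ∅)
open import Data.Fin.Subset.Properties
  using (_∈?_; ∣p∣≤n; p⊂q⇒∣p∣<∣q∣; p⊆p∪q; x∈p∪q⁺; x∈p∪q⁻; x∈⁅x⁆; x∈⁅y⁆⇒x≡y; p─⊥≡p; p─q⊆p;
         x∈p∧x≢y⇒x∈p-y; drop-there; Lift?; ∉⊥; Empty-unique; ∣⊥∣≡0)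
open import Data.Vec using ([]; _∷_; lookup; tabulate; there)
open import Data.Vec.Properties using (lookup∘tabulate; []=⇒lookup; lookup⇒[]=)
open import Data.Product using (_×_; _,_; ∃-syntax; proj₁; proj₂)
open import Data.Sum using (_⊎_; inj₁; inj₂; [_,_]; [_,_]′)
open import Function using (_∘_; id)
open import Relation.Nullary using (¬_; Dec; yes; no; does; ¬?; _×-dec_; _→-dec_; _⊎-dec_; contradiction)
open import Relation.Nullary.Decidable using (decidable-stable; dec-true; ¬¬-excluded-middle)
open import Relation.Nullary.Negation using (¬¬-map)
open import Relation.Binary.PropositionalEquality
  using (_≡_; _≢_; refl; sym; trans; cong; cong₂; subst)

open ≤-Reasoning

*-≤-sum : ∀ {m} k {f : Fin m → ℕ} → (∀ i → k ≤ f i) → m * k ≤ sum f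
*-≤-sum {zero}  k _   = z≤n
*-≤-sum {suc m} k k≤f = +-mono-≤ (k≤f zero) (*-≤-sum k (k≤f ∘ suc))

≤-sum : ∀ {m} (f : Fin m → ℕ) i → f i ≤ sum f
≤-sum f zero    = m≤m+n (f zero) _
≤-sum f (suc i) = ≤-trans (≤-sum (f ∘ suc) i) (m≤n+m _ (f zero))

+-≤-sum : ∀ {m} (f : Fin m → ℕ) {i j} → i ≢ j → f i + f j ≤ sum f
+-≤-sum f {zero}  {zero}  i≢j = contradiction refl i≢j
+-≤-sum f {zero}  {suc j} _   = +-monoʳ-≤ (f zero) (≤-sum (f ∘ suc) j)
+-≤-sum f {suc i} {zero}  _   =
  ≤-trans (≤-reflexive (+-comm (f (suc i)) (f zero))) (+-monoʳ-≤ (f zero) (≤-sum (f ∘ suc) i))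
+-≤-sum f {suc i} {suc j} i≢j = ≤-trans (+-≤-sum (f ∘ suc) (i≢j ∘ cong suc)) (m≤n+m _ (f zero))

sum-≤-∣∣* : ∀ {m} (S : Subset m) {c} {f : Fin m → ℕ} →
            (∀ i → f i ≤ c) → (∀ i → i ∉ S → f i ≡ 0) → sum f ≤ ∣ S ∣ * c
sum-≤-∣∣* []            _   _   = z≤n
sum-≤-∣∣* (inside ∷ S)  f≤c f≡0 =
  +-mono-≤ (f≤c zero) (sum-≤-∣∣* S (f≤c ∘ suc) (λ i i∉S → f≡0 (suc i) (i∉S ∘ drop-there)))
sum-≤-∣∣* (outside ∷ S) {f = f} f≤c f≡0 =
  ≤-trans (≤-reflexive (cong (_+ sum (f ∘ suc)) (f≡0 zero λ ())))
          (sum-≤-∣∣* S (f≤c ∘ suc) (λ i i∉S → f≡0 (suc i) (i∉S ∘ drop-there)))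

m*[n+n]≡m*n*2 : ∀ m n → m * (n + n) ≡ m * n * 2
m*[n+n]≡m*n*2 = solve-∀

χ : ∀ {m} → Subset m → Fin m → ℕ
χ p i = if lookup p i then 1 else 0

∣p∣≡∑χ : ∀ {m} (p : Subset m) → ∣ p ∣ ≡ sum (χ p)
∣p∣≡∑χ []            = refl
∣p∣≡∑χ (inside ∷ p)  = cong suc (∣p∣≡∑χ p)
∣p∣≡∑χ (outside ∷ p) = ∣p∣≡∑χ p

χ-∈ : ∀ {m} {p : Subset m} {i} → i ∈ p → χ p i ≡ 1
χ-∈ i∈p = cong (if_then 1 else 0) ([]=⇒lookup i∈p)

module _ {m : ℕ} where

  subset : {P : Fin m → Set} → (∀ i → Dec (P i)) → Subset m
  subset P? = tabulate (does ∘ P?)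

  ∈-subset⁺ : {P : Fin m → Set} (P? : ∀ i → Dec (P i)) {i : Fin m} → P i → i ∈ subset P?
  ∈-subset⁺ P? {i} p =
    lookup⇒[]= i (subset P?) (trans (lookup∘tabulate (does ∘ P?) i) (dec-true (P? i) p))

  ∈-subset⁻ : {P : Fin m → Set} (P? : ∀ i → Dec (P i)) {i : Fin m} → i ∈ subset P? → P i
  ∈-subset⁻ P? {i} i∈ with P? i | trans (sym (lookup∘tabulate (does ∘ P?) i)) ([]=⇒lookup i∈)
  ... | yes p | _ = p
  ... | no _  | ()

  ∈-∪⁅⁆⁻ : ∀ {p : Subset m} {x y} → y ∈ p ∪ ⁅ x ⁆ → y ∈ p ⊎ y ≡ x
  ∈-∪⁅⁆⁻ {p} {x} y∈ with x∈p∪q⁻ p ⁅ x ⁆ y∈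
  ... | inj₁ y∈p  = inj₁ y∈p
  ... | inj₂ y∈⁅x⁆ = inj₂ (x∈⁅y⁆⇒x≡y x y∈⁅x⁆)

  x∈p∪⁅x⁆ : ∀ {p : Subset m} x → x ∈ p ∪ ⁅ x ⁆
  x∈p∪⁅x⁆ x = x∈p∪q⁺ (inj₂ (x∈⁅x⁆ x))

  p∪⁅x⁆⊆q : ∀ {p q : Subset m} {x} → p ⊆ q → x ∈ q → p ∪ ⁅ x ⁆ ⊆ q
  p∪⁅x⁆⊆q p⊆q x∈q y∈ with ∈-∪⁅⁆⁻ y∈
  ... | inj₁ y∈p = p⊆q y∈p
  ... | inj₂ refl = x∈q

  x∉p⇒∣p∣<∣p∪⁅x⁆∣ : ∀ {p : Subset m} {x} → x ∉ p → ∣ p ∣ < ∣ p ∪ ⁅ x ⁆ ∣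
  x∉p⇒∣p∣<∣p∪⁅x⁆∣ {p} {x} x∉p = p⊂q⇒∣p∣<∣q∣ (p⊆p∪q ⁅ x ⁆ , x , x∈p∪⁅x⁆ x , x∉p)

x∉p-x : ∀ {m} (p : Subset m) x → x ∉ p - x
x∉p-x (_ ∷ p) (suc x) (there x∈) = x∉p-x p x x∈

x∈p-y⁻ : ∀ {m} {p : Subset m} {x y} → x ∈ p - y → x ∈ p × x ≢ y
x∈p-y⁻ {p = p} {y = y} x∈ = p─q⊆p p ⁅ y ⁆ x∈ , λ { refl → x∉p-x p y x∈ }

∣p∣≤1+∣p-x∣ : ∀ {m} (p : Subset m) x → ∣ p ∣ ≤ suc ∣ p - x ∣
∣p∣≤1+∣p-x∣ (inside ∷ p)  zero    = s≤s (≤-reflexive (cong ∣_∣ (sym (p─⊥≡p p))))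
∣p∣≤1+∣p-x∣ (outside ∷ p) zero    = ≤-trans (≤-reflexive (cong ∣_∣ (sym (p─⊥≡p p)))) (n≤1+n _)
∣p∣≤1+∣p-x∣ (inside ∷ p)  (suc x) = s≤s (∣p∣≤1+∣p-x∣ p x)
∣p∣≤1+∣p-x∣ (outside ∷ p) (suc x) = ∣p∣≤1+∣p-x∣ p x

Maximal : ∀ {m} → (Subset m → Set) → Subset m → Set
Maximal P X = P X × (∀ T → P T → X ⊆ T → T ⊆ X)

module _ {m} {P : Subset m → Set} (P? : ∀ X → Dec (P X)) where

  private
    -- k is fuel: each step enlarges X, so m steps suffice.
    grow : ∀ k X → m ≤ ∣ X ∣ + k → P X →
           ∃[ Y ] (X ⊆ Y × P Y × (∀ x → x ∉ Y → ¬ P (Y ∪ ⁅ x ⁆)))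
    grow k X _ PX with any? (λ x → ¬? (x ∈? X) ×-dec P? (X ∪ ⁅ x ⁆))
    ... | no ¬growable = X , id , PX , λ x x∉X PX∪x → ¬growable (x , x∉X , PX∪x)
    grow zero X m≤∣X∣ _ | yes (x , x∉X , _) =
      contradiction (≤-trans (∣p∣≤n (X ∪ ⁅ x ⁆)) (≤-trans m≤∣X∣ (≤-reflexive (+-identityʳ _))))
                    (<⇒≱ (x∉p⇒∣p∣<∣p∪⁅x⁆∣ x∉X))
    grow (suc k) X m≤∣X∣+k _ | yes (x , x∉X , PX∪x)
      with grow k (X ∪ ⁅ x ⁆) (≤-trans m≤∣X∣+k (≤-trans (≤-reflexive (+-suc _ k))
                                 (+-monoˡ-≤ k (x∉p⇒∣p∣<∣p∪⁅x⁆∣ x∉X)))) PX∪x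
    ... | Y , X∪x⊆Y , rest = Y , X∪x⊆Y ∘ p⊆p∪q ⁅ x ⁆ , rest

  maximal-⊇ : (∀ {X T} → X ⊆ T → P T → P X) → ∀ X → P X → ∃[ Y ] (X ⊆ Y × Maximal P Y)
  maximal-⊇ hereditary X PX with grow m X (m≤n+m m ∣ X ∣) PX
  ... | Y , X⊆Y , PY , saturated = Y , X⊆Y , PY , λ T PT Y⊆T {x} x∈T →
    decidable-stable (x ∈? Y) (λ x∉Y → saturated x x∉Y (hereditary (p∪⁅x⁆⊆q Y⊆T x∈T) PT))

module _ {n} (G : Graph n) (adj? : ∀ u v → Dec (Graph.Adj G u v)) where
  open Graph G renaming (sym to adj-sym)

  clique? : ∀ X → Dec (IsClique G X)
  clique? X = all? λ u → all? λ v → (u ∈? X) →-dec ((v ∈? X) →-dec (¬? (u ≟ v) →-dec adj? u v))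

  stable? : ∀ X → Dec (IsStable G X)
  stable? X = all? λ u → all? λ v → (u ∈? X) →-dec ((v ∈? X) →-dec ¬? (adj? u v))

  clique-⊆ : ∀ {X T} → X ⊆ T → IsClique G T → IsClique G X
  clique-⊆ X⊆T T-clique u v u∈X v∈X = T-clique u v (X⊆T u∈X) (X⊆T v∈X)

  stable-⊆ : ∀ {X T} → X ⊆ T → IsStable G T → IsStable G X
  stable-⊆ X⊆T T-stable u v u∈X v∈X = T-stable u v (X⊆T u∈X) (X⊆T v∈X)

  ⁅⁆-clique : ∀ x → IsClique G ⁅ x ⁆
  ⁅⁆-clique x u v u∈ v∈ u≢v with x∈⁅y⁆⇒x≡y x u∈ | x∈⁅y⁆⇒x≡y x v∈
  ... | refl | refl = contradiction refl u≢v

  ⁅⁆-stable : ∀ x → IsStable G ⁅ x ⁆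
  ⁅⁆-stable x u v u∈ v∈ with x∈⁅y⁆⇒x≡y x u∈ | x∈⁅y⁆⇒x≡y x v∈
  ... | refl | refl = irrefl

  ∪⁅⁆-clique : ∀ {X x} → IsClique G X → (∀ u → u ∈ X → u ≢ x → Adj u x) → IsClique G (X ∪ ⁅ x ⁆)
  ∪⁅⁆-clique X-clique x-adj u v u∈ v∈ u≢v with ∈-∪⁅⁆⁻ u∈ | ∈-∪⁅⁆⁻ v∈
  ... | inj₁ u∈X | inj₁ v∈X = X-clique u v u∈X v∈X u≢v
  ... | inj₁ u∈X | inj₂ refl = x-adj u u∈X u≢v
  ... | inj₂ refl | inj₁ v∈X = adj-sym (x-adj v v∈X (u≢v ∘ sym))
  ... | inj₂ refl | inj₂ refl = contradiction refl u≢v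

  ∪⁅⁆-stable : ∀ {X x} → IsStable G X → (∀ u → u ∈ X → ¬ Adj u x) → IsStable G (X ∪ ⁅ x ⁆)
  ∪⁅⁆-stable X-stable x-nonadj u v u∈ v∈ with ∈-∪⁅⁆⁻ u∈ | ∈-∪⁅⁆⁻ v∈
  ... | inj₁ u∈X | inj₁ v∈X = X-stable u v u∈X v∈X
  ... | inj₁ u∈X | inj₂ refl = x-nonadj u u∈X
  ... | inj₂ refl | inj₁ v∈X = x-nonadj v v∈X ∘ adj-sym
  ... | inj₂ refl | inj₂ refl = irrefl

  pair-clique : ∀ {a b} → Adj a b → IsClique G (⁅ a ⁆ ∪ ⁅ b ⁆)
  pair-clique {a} a~b = ∪⁅⁆-clique (⁅⁆-clique a) λ u u∈ _ →
    subst (λ u → Adj u _) (sym (x∈⁅y⁆⇒x≡y a u∈)) a~b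

  pair-stable : ∀ {a b} → ¬ Adj a b → IsStable G (⁅ a ⁆ ∪ ⁅ b ⁆)
  pair-stable {a} a≁b = ∪⁅⁆-stable (⁅⁆-stable a) λ u u∈ →
    subst (λ u → ¬ Adj u _) (sym (x∈⁅y⁆⇒x≡y a u∈)) a≁b

  ¬clique-∪⁅⁆ : ∀ {X x} → IsClique G X → ¬ IsClique G (X ∪ ⁅ x ⁆) →
                ∃[ p ] (p ∈ X × p ≢ x × ¬ Adj p x)
  ¬clique-∪⁅⁆ {X} {x} X-clique ¬clique
    with ¬∀⟶∃¬ n (λ p → p ∈ X → p ≢ x → Adj p x)
                 (λ p → (p ∈? X) →-dec (¬? (p ≟ x) →-dec adj? p x))
                 (¬clique ∘ ∪⁅⁆-clique X-clique)
  ... | p , ¬adjacent = p , decidable-stable (p ∈? X) (λ p∉X → ¬adjacent λ p∈X → contradiction p∈X p∉X)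
                          , (λ p≡x → ¬adjacent λ _ p≢x → contradiction p≡x p≢x)
                          , (λ p~x → ¬adjacent λ _ _ → p~x)

  maximalClique-⊇ : ∀ Q → IsClique G Q → ∃[ C ] (Q ⊆ C × IsMaximalClique G C)
  maximalClique-⊇ = maximal-⊇ clique? clique-⊆

  maximalStable-⊇ : ∀ J → IsStable G J → ∃[ I ] (J ⊆ I × IsMaximalStable G I)
  maximalStable-⊇ = maximal-⊇ stable? stable-⊆

  CliqueIn : Fin n → Subset n → Set
  CliqueIn s X = IsClique G X × Lift (Adj s) X

  maximalCliqueIn : ∀ s → ∃[ K ] Maximal (CliqueIn s) K
  maximalCliqueIn s with maximal-⊇ (λ X → clique? X ×-dec Lift? (adj? s) X)
                                   (λ X⊆T (T-clique , T⊆N) → clique-⊆ X⊆T T-clique , T⊆N ∘ X⊆T)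
                                   ∅ ((λ u _ u∈ → contradiction u∈ ∉⊥) , λ x∈ → contradiction x∈ ∉⊥)
  ... | K , _ , K-maximal = K , K-maximal

  ≁-≢ : ∀ {u v w} → ¬ Adj u w → Adj v w → u ≢ v
  ≁-≢ u≁w v~w refl = u≁w v~w

  cis-meet : IsCIS G → ∀ {Q J} → IsClique G Q → IsStable G J →
             ∃[ z ] ((∀ q → q ∈ Q → q ≢ z → Adj q z) × (∀ j → j ∈ J → ¬ Adj z j))
  cis-meet cis {Q} {J} Q-clique J-stable
    with maximalClique-⊇ Q Q-clique | maximalStable-⊇ J J-stable
  ... | C , Q⊆C , C-maximal | I , J⊆I , I-maximal with cis C I C-maximal I-maximal
  ... | z , z∈C , z∈I = z , (λ q q∈Q → proj₁ C-maximal q z (Q⊆C q∈Q) z∈C)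
                          , (λ j j∈J → proj₁ I-maximal z j z∈I (J⊆I j∈J))

  third-neighbour-adjacent : IsClawFree G → ∀ {s x y z} → Adj s x → Adj s y → ¬ Adj x y → x ≢ y →
                             Adj s z → z ≢ x → z ≢ y → Adj z x ⊎ Adj z y
  third-neighbour-adjacent claw-free {s} {x} {y} {z} s~x s~y x≁y x≢y s~z z≢x z≢y
    with adj? z x | adj? z y
  ... | yes z~x | _       = inj₁ z~x
  ... | no _    | yes z~y = inj₂ z~y
  ... | no z≁x  | no z≁y  = contradiction (s~x , s~y , s~z , x≁y , z≁x ∘ adj-sym , z≁y ∘ adj-sym)
                                          (claw-free s x y z x≢y (z≢x ∘ sym) (z≢y ∘ sym))

  outside-maximalCliqueIn-adjacent : IsClawFree G → IsCIS G → ∀ {s K} → Maximal (CliqueIn s) K →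
                                     ∀ {x y} → Adj s x → Adj s y → x ∉ K → y ∉ K → x ≢ y → Adj x y
  outside-maximalCliqueIn-adjacent claw-free cis {s} {K} ((K-clique , K⊆N) , K-maximal) {x} {y}
                                   s~x s~y x∉K y∉K x≢y = decidable-stable (adj? x y) λ x≁y →
    let p , p∈K , p≢x , p≁x = escape s~x x∉K
        q , q∈K , q≢y , q≁y = escape s~y y∉K
        z , z-complete , z-anti = cis-meet cis K∪s-clique (pair-stable x≁y)
        x∈J = p⊆p∪q ⁅ y ⁆ (x∈⁅x⁆ x)
        y∈J = x∈p∪⁅x⁆ y
        s~z = z-complete s (x∈p∪⁅x⁆ s) (≁-≢ (z-anti x x∈J) s~x ∘ sym)
    in [ z-anti x x∈J , z-anti y y∈J ]
         (third-neighbour-adjacent claw-free s~x s~y x≁y x≢y s~z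
           (misses z-complete p∈K p≢x p≁x) (misses z-complete q∈K q≢y q≁y))
    where
    K∪s-clique : IsClique G (K ∪ ⁅ s ⁆)
    K∪s-clique = ∪⁅⁆-clique K-clique λ u u∈K _ → adj-sym (K⊆N u∈K)
    misses : ∀ {z p w} → (∀ q → q ∈ K ∪ ⁅ s ⁆ → q ≢ z → Adj q z) → p ∈ K → p ≢ w → ¬ Adj p w → z ≢ w
    misses z-complete p∈K p≢w p≁w refl = p≁w (z-complete _ (p⊆p∪q ⁅ s ⁆ p∈K) p≢w)
    escape : ∀ {w} → Adj s w → w ∉ K → ∃[ p ] (p ∈ K × p ≢ w × ¬ Adj p w)
    escape {w} s~w w∉K = ¬clique-∪⁅⁆ K-clique λ K∪w-clique →
      w∉K (K-maximal (K ∪ ⁅ w ⁆) (K∪w-clique , [ K⊆N , (λ { refl → s~w }) ] ∘ ∈-∪⁅⁆⁻)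
                     (p⊆p∪q ⁅ w ⁆) (x∈p∪⁅x⁆ w))

  module MaximumStable (claw-free : IsClawFree G) (cis : IsCIS G)
                       (S : Subset n) (S-stable : IsStable G S)
                       (S-maximum : ∀ T → IsStable G T → ∣ T ∣ ≤ ∣ S ∣) where

    no-larger-stable : ∀ {T} → IsStable G T → ¬ ∣ S ∣ < ∣ T ∣
    no-larger-stable T-stable ∣S∣<∣T∣ = <⇒≱ ∣S∣<∣T∣ (S-maximum _ T-stable)

    adjacent-∉ : ∀ {s x} → s ∈ S → Adj x s → x ∉ S
    adjacent-∉ s∈S x~s x∈S = S-stable _ _ x∈S s∈S x~s

    dominating : ∀ {v} → v ∉ S → ∃[ s ] (s ∈ S × Adj v s)
    dominating {v} v∉S with any? (λ s → (s ∈? S) ×-dec adj? v s)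
    ... | yes found = found
    ... | no ¬found = contradiction (x∉p⇒∣p∣<∣p∪⁅x⁆∣ v∉S)
                        (no-larger-stable (∪⁅⁆-stable S-stable λ u u∈S u~v → ¬found (u , u∈S , adj-sym u~v)))

    SeesOnly : Fin n → Fin n → Set
    SeesOnly s x = ∀ t → t ∈ S → t ≢ s → ¬ Adj x t

    seesOnly-or-other : ∀ s x → SeesOnly s x ⊎ ∃[ t ] (t ∈ S × t ≢ s × Adj x t)
    seesOnly-or-other s x with any? (λ t → (t ∈? S) ×-dec (¬? (t ≟ s) ×-dec adj? x t))
    ... | yes other = inj₂ other
    ... | no ¬other = inj₁ λ t t∈S t≢s x~t → ¬other (t , t∈S , t≢s , x~t)

    S-s-nonadjacent : ∀ {s w} → SeesOnly s w → ∀ u → u ∈ S - s → ¬ Adj u w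
    S-s-nonadjacent w-only u u∈ u~w = w-only u (proj₁ (x∈p-y⁻ u∈)) (proj₂ (x∈p-y⁻ u∈)) (adj-sym u~w)

    S-s∪⁅⁆-stable : ∀ {s w} → SeesOnly s w → IsStable G ((S - s) ∪ ⁅ w ⁆)
    S-s∪⁅⁆-stable w-only = ∪⁅⁆-stable (stable-⊆ (p─q⊆p S _) S-stable) (S-s-nonadjacent w-only)

    ∈S-s∪⁅⁆ : ∀ {s t w} → t ∈ S → t ≢ s → t ∈ (S - s) ∪ ⁅ w ⁆
    ∈S-s∪⁅⁆ t∈S t≢s = p⊆p∪q _ (x∈p∧x≢y⇒x∈p-y t∈S t≢s)

    seesOnly-adjacent : ∀ {s x y} → s ∈ S → x ∉ S → y ∉ S → x ≢ y →
                        SeesOnly s x → SeesOnly s y → Adj x y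
    seesOnly-adjacent {s} {x} {y} s∈S x∉S y∉S x≢y x-only y-only =
      decidable-stable (adj? x y) λ x≁y → no-larger-stable (T-stable x≁y) larger
      where
      T-stable : ¬ Adj x y → IsStable G (((S - s) ∪ ⁅ x ⁆) ∪ ⁅ y ⁆)
      T-stable x≁y = ∪⁅⁆-stable (S-s∪⁅⁆-stable x-only)
                                λ u → [ S-s-nonadjacent y-only u , (λ { refl → x≁y }) ] ∘ ∈-∪⁅⁆⁻
      larger : ∣ S ∣ < ∣ ((S - s) ∪ ⁅ x ⁆) ∪ ⁅ y ⁆ ∣
      larger = begin-strict
        ∣ S ∣                         ≤⟨ ∣p∣≤1+∣p-x∣ S s ⟩
        suc ∣ S - s ∣                 ≤⟨ x∉p⇒∣p∣<∣p∪⁅x⁆∣ (x∉S ∘ proj₁ ∘ x∈p-y⁻ {y = s}) ⟩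
        ∣ (S - s) ∪ ⁅ x ⁆ ∣           <⟨ x∉p⇒∣p∣<∣p∪⁅x⁆∣ y∉S-s∪x ⟩
        ∣ ((S - s) ∪ ⁅ x ⁆) ∪ ⁅ y ⁆ ∣ ∎
        where
        y∉S-s∪x : y ∉ (S - s) ∪ ⁅ x ⁆
        y∉S-s∪x = [ y∉S ∘ proj₁ ∘ x∈p-y⁻ {y = s} , x≢y ∘ sym ]′ ∘ ∈-∪⁅⁆⁻

    seesOnly-adjacent-to-other : ∀ {s v t a} → s ∈ S → Adj v s → t ∈ S → t ≢ s → Adj v t →
                                 Adj a s → SeesOnly s a → v ≢ a → Adj v a
    -- CIS for the clique {v, s} and the stable set (S - s) ∪ {a} yields a vertex z private to s
    -- and non-adjacent to a, contradicting seesOnly-adjacent.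
    seesOnly-adjacent-to-other {s} {v} {t} {a} s∈S v~s t∈S t≢s v~t a~s a-only v≢a =
      decidable-stable (adj? v a) λ v≁a →
        let z , z-complete , z-anti = cis-meet cis (pair-clique v~s) (S-s∪⁅⁆-stable a-only)
            a∈J = x∈p∪⁅x⁆ a
            v~z = z-complete v (p⊆p∪q ⁅ s ⁆ (x∈⁅x⁆ v)) (≁-≢ (z-anti t (∈S-s∪⁅⁆ t∈S t≢s)) v~t ∘ sym)
            s~z = z-complete s (x∈p∪⁅x⁆ s) (≁-≢ (z-anti a a∈J) (adj-sym a~s) ∘ sym)
            z-only : SeesOnly s _
            z-only = λ u u∈S u≢s → z-anti u (∈S-s∪⁅⁆ u∈S u≢s)
            a≢z = ≁-≢ (v≁a ∘ adj-sym) (adj-sym v~z)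
        in z-anti a a∈J (adj-sym (seesOnly-adjacent s∈S (adjacent-∉ s∈S a~s) (adjacent-∉ s∈S (adj-sym s~z))
                                                     a≢z a-only z-only))

    Private : Fin n → Fin n → Set
    Private s x = (x ≡ s ⊎ Adj x s) × SeesOnly s x

    private? : ∀ s x → Dec (Private s x)
    private? s x = ((x ≟ s) ⊎-dec adj? x s)
             ×-dec all? (λ t → (t ∈? S) →-dec (¬? (t ≟ s) →-dec ¬? (adj? x t)))

    private-complete : ∀ {s a x} → s ∈ S → Private s a → x ≡ s ⊎ Adj x s → x ≢ a → Adj x a
    private-complete _ (inj₁ refl , _) (inj₁ refl) x≢a = contradiction refl x≢a
    private-complete _ (inj₁ refl , _) (inj₂ x~s)  _   = x~s
    private-complete _ (inj₂ a~s , _)  (inj₁ refl) _   = adj-sym a~s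
    private-complete {s} {a} {x} s∈S (inj₂ a~s , a-only) (inj₂ x~s) x≢a with seesOnly-or-other s x
    ... | inj₁ x-only = seesOnly-adjacent s∈S (adjacent-∉ s∈S x~s) (adjacent-∉ s∈S a~s) x≢a x-only a-only
    ... | inj₂ (t , t∈S , t≢s , x~t) = seesOnly-adjacent-to-other s∈S x~s t∈S t≢s x~t a~s a-only x≢a

    -- Empty unless s ∈ S, so that summing over all vertices counts only the cliques of S.
    withPrivate? : ∀ s B x → Dec (s ∈ S × (x ∈ B ⊎ Private s x))
    withPrivate? s B x = (s ∈? S) ×-dec ((x ∈? B) ⊎-dec private? s x)

    withPrivate : Fin n → Subset n → Subset n
    withPrivate s B = subset (withPrivate? s B)

    withPrivate-clique : ∀ {s B} → CliqueIn s B → IsClique G (withPrivate s B)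
    withPrivate-clique {s} {B} (B-clique , B⊆N) u v u∈ v∈ u≢v
      with ∈-subset⁻ (withPrivate? s B) u∈ | ∈-subset⁻ (withPrivate? s B) v∈
    ... | s∈S , inj₁ u∈B     | _ , inj₁ v∈B     = B-clique u v u∈B v∈B u≢v
    ... | s∈S , u∈B⊎private | _ , inj₂ v-private =
      private-complete s∈S v-private ([ inj₂ ∘ adj-sym ∘ B⊆N , proj₁ ] u∈B⊎private) u≢v
    ... | s∈S , inj₂ u-private | _ , inj₁ v∈B   =
      adj-sym (private-complete s∈S u-private (inj₂ (adj-sym (B⊆N v∈B))) (u≢v ∘ sym))

    K : Fin n → Subset n
    K s = proj₁ (maximalCliqueIn s)

    K-cliqueIn : ∀ s → CliqueIn s (K s)
    K-cliqueIn s = proj₁ (proj₂ (maximalCliqueIn s))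

    L? : ∀ s x → Dec (Adj s x × x ∉ K s)
    L? s x = adj? s x ×-dec ¬? (x ∈? K s)

    L : Fin n → Subset n
    L s = subset (L? s)

    L-cliqueIn : ∀ s → CliqueIn s (L s)
    L-cliqueIn s = (λ x y x∈ y∈ → outside-maximalCliqueIn-adjacent claw-free cis (proj₂ (maximalCliqueIn s))
                                   (proj₁ (∈-subset⁻ (L? s) x∈)) (proj₁ (∈-subset⁻ (L? s) y∈))
                                   (proj₂ (∈-subset⁻ (L? s) x∈)) (proj₂ (∈-subset⁻ (L? s) y∈)))
                 , proj₁ ∘ ∈-subset⁻ (L? s)

    K⁺ L⁺ : Fin n → Subset n
    K⁺ s = withPrivate s (K s)
    L⁺ s = withPrivate s (L s)

    covers : Fin n → Fin n → ℕ
    covers s v = χ (K⁺ s) v + χ (L⁺ s) v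

    private-covered-twice : ∀ {s v} → s ∈ S → Private s v → 2 ≤ covers s v
    private-covered-twice {s} s∈S v-private = ≤-reflexive (sym (cong₂ _+_
      (χ-∈ (∈-subset⁺ (withPrivate? s (K s)) (s∈S , inj₂ v-private)))
      (χ-∈ (∈-subset⁺ (withPrivate? s (L s)) (s∈S , inj₂ v-private)))))

    neighbour-covered : ∀ {s v} → s ∈ S → Adj s v → 1 ≤ covers s v
    neighbour-covered {s} {v} s∈S s~v with v ∈? K s
    ... | yes v∈K = ≤-trans (≤-reflexive (sym (χ-∈ (∈-subset⁺ (withPrivate? s (K s)) (s∈S , inj₁ v∈K)))))
                            (m≤m+n _ _)
    ... | no v∉K  = ≤-trans (≤-reflexive (sym (χ-∈ (∈-subset⁺ (withPrivate? s (L s))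
                                                              (s∈S , inj₁ (∈-subset⁺ (L? s) (s~v , v∉K)))))))
                            (m≤n+m _ _)

    covered-twice : ∀ v → 2 ≤ sum (λ s → covers s v)
    covered-twice v with v ∈? S
    ... | yes v∈S = ≤-trans (private-covered-twice v∈S (inj₁ refl , λ t t∈S _ → S-stable v t v∈S t∈S))
                            (≤-sum _ v)
    ... | no v∉S with dominating v∉S
    ...   | s , s∈S , v~s with seesOnly-or-other s v
    ...     | inj₁ v-only = ≤-trans (private-covered-twice s∈S (inj₂ v~s , v-only)) (≤-sum _ s)
    ...     | inj₂ (t , t∈S , t≢s , v~t) =
      ≤-trans (+-mono-≤ (neighbour-covered s∈S (adj-sym v~s)) (neighbour-covered t∈S (adj-sym v~t)))
              (+-≤-sum _ (t≢s ∘ sym))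

    withPrivate-∉ : ∀ {s} B → s ∉ S → ∣ withPrivate s B ∣ ≡ 0
    withPrivate-∉ {s} B s∉S = trans (cong ∣_∣ (Empty-unique λ (x , x∈) →
                                      s∉S (proj₁ (∈-subset⁻ (withPrivate? s B) x∈))))
                                    (∣⊥∣≡0 n)

    double-count : ∀ {ω} → (∀ C → IsClique G C → ∣ C ∣ ≤ ω) → n * 2 ≤ ∣ S ∣ * ω * 2
    double-count {ω} ω-maximum = begin
      n * 2                              ≤⟨ *-≤-sum 2 covered-twice ⟩
      sum (λ v → sum (λ s → covers s v)) ≡⟨ ∑-comm covers ⟨
      sum (λ s → sum (covers s))         ≡⟨ sum-cong-≗ sizes ⟨
      sum (λ s → ∣ K⁺ s ∣ + ∣ L⁺ s ∣)    ≤⟨ sum-≤-∣∣* S bounded outside-S ⟩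
      ∣ S ∣ * (ω + ω)                    ≡⟨ m*[n+n]≡m*n*2 ∣ S ∣ ω ⟩
      ∣ S ∣ * ω * 2                      ∎
      where
      sizes : ∀ s → ∣ K⁺ s ∣ + ∣ L⁺ s ∣ ≡ sum (covers s)
      sizes s = trans (cong₂ _+_ (∣p∣≡∑χ (K⁺ s)) (∣p∣≡∑χ (L⁺ s))) (sym (∑-distrib-+ (χ (K⁺ s)) (χ (L⁺ s))))
      bounded : ∀ s → ∣ K⁺ s ∣ + ∣ L⁺ s ∣ ≤ ω + ω
      bounded s = +-mono-≤ (ω-maximum _ (withPrivate-clique (K-cliqueIn s)))
                           (ω-maximum _ (withPrivate-clique (L-cliqueIn s)))
      outside-S : ∀ s → s ∉ S → ∣ K⁺ s ∣ + ∣ L⁺ s ∣ ≡ 0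
      outside-S s s∉S = cong₂ _+_ (withPrivate-∉ (K s) s∉S) (withPrivate-∉ (L s) s∉S)

¬¬-∀-Fin : ∀ {m} {P : Fin m → Set} → (∀ i → ¬ ¬ P i) → ¬ ¬ (∀ i → P i)
¬¬-∀-Fin {zero}  _   ¬all = ¬all λ ()
¬¬-∀-Fin {suc m} ¬¬P ¬all = ¬¬P zero λ P₀ → ¬¬-∀-Fin (¬¬P ∘ suc) λ Pₛ →
  ¬all λ { zero → P₀ ; (suc i) → Pₛ i }

theorem18 : (n : ℕ) (G : Graph (suc n)) → IsClawFree G → IsCIS G →
            (α ω : ℕ) → IsStabilityNumber G α → IsCliqueNumber G ω →
            suc n ≤ α * ω
theorem18 n G claw-free cis α ω ((S , S-stable , ∣S∣≡α) , α-maximum) (_ , ω-maximum) =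
  -- Adjacency need not be decidable, but the goal is, so excluded middle for Adj may be assumed.
  decidable-stable (suc n ≤? α * ω)
    (¬¬-map bound (¬¬-∀-Fin λ u → ¬¬-∀-Fin λ v → ¬¬-excluded-middle))
  where
  bound : (∀ u v → Dec (Graph.Adj G u v)) → suc n ≤ α * ω
  bound adj? = *-cancelʳ-≤ (suc n) (α * ω) 2
    (subst (λ k → suc n * 2 ≤ k * ω * 2) ∣S∣≡α (double-count ω-maximum))
    where
    open MaximumStable G adj? claw-free cis S S-stable
                       (λ T T-stable → subst (∣ T ∣ ≤_) (sym ∣S∣≡α) (α-maximum T T-stable))
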